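{- Let $\mathcal A_n=\mathrm{Av}_n(132,231)$, so that $|\mathcal A_n|=2^{n-1}$. For $n\ge2$, the total number of consecutive occurrences of $321$ over all permutations of $\mathcal A_n$ is $\mathbf{321}_n=\sum_{k=1}^{n-1}\binom{n-1}{k}(k-1)=(n-1)2^{n-2}-2^{n-1}+1$. Moreover $\mathrm{pop}_{\mathcal A}(321)=\mathrm{pop}_{\mathcal A}(123)=1/2$ and $\mathrm{pop}_{\mathcal A}(213)=\mathrm{pop}_{\mathcal A}(312)=0$.
   Context: A permutation $\pi=a_1\dots a_n$ contains a consecutive occurrence of a pattern $p\in\mathcal S_r$ at position $i$ if $a_i\dots a_{i+r-1}$ is order-isomorphic to $p$; $\mathrm{Av}_n(p_1,\dots,p_k)$ is the set of permutations of size $n$ with no consecutive occurrence of any $p_j$. For a class $\mathcal A_n$ and a pattern $p$, $\mathbf p_n^{\mathcal A}$ is the total number of consecutive occurrences of $p$ over all permutations of $\mathcal A_n$, and $\mathrm{pop}_{\mathcal A}(p)=\lim_{n\to\infty}\frac{\mathbf p_n^{\mathcal A}}{n|\mathcal A_n|}$ when it exists. -}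

module Defs where

open import Data.Bool using (Bool; true; false; _∧_; if_then_else_)
open import Data.Nat using (ℕ; zero; suc; _+_; _*_; _∸_; _<ᵇ_; _≡ᵇ_)
open import Data.List using (List; []; _∷_; map; concatMap; filter; length; take; upTo; zipWith)
open import Data.Nat.ListAction using (sum)
open import Data.Bool.ListAction using (and; all)
open import Data.Integer using (+_)
open import Data.Rational using (ℚ; 0ℚ; _/_; _-_; ∣_∣; _<_)
open import Data.Product using (∃)
open import Relation.Nullary.Decidable using (does)
open import Data.Bool.Properties using (_≟_)

_==ᴮ_ : Bool → Bool → Bool
a ==ᴮ b = does (a ≟ b)

allLists : ℕ → ℕ → List (List ℕ)
allLists m zero = [] ∷ []
allLists m (suc k) = concatMap (λ v → map (v ∷_) (allLists m k)) (map suc (upTo m))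

notIn : ℕ → List ℕ → Bool
notIn x xs = all (λ y → does (Data.Bool.Properties._≟_ (x ≡ᵇ y) false)) xs

distinct : List ℕ → Bool
distinct [] = true
distinct (x ∷ xs) = notIn x xs ∧ distinct xs

-- S_n : permutations of [1..n] in one-line notation a₁…aₙ
perms : ℕ → List (List ℕ)
perms n = filter (λ xs → distinct xs Data.Bool.≟ true) (allLists n n)

orderIso : List ℕ → List ℕ → Bool
orderIso [] [] = true
orderIso [] (_ ∷ _) = false
orderIso (_ ∷ _) [] = false
orderIso (x ∷ xs) (y ∷ ys) =
  and (zipWith (λ x' y' → ((x <ᵇ x') ==ᴮ (y <ᵇ y')) ∧ ((x' <ᵇ x) ==ᴮ (y' <ᵇ y))) xs ys)
  ∧ orderIso xs ys

occ : List ℕ → List ℕ → ℕ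
occ p [] = 0
occ p (x ∷ xs) = (if orderIso p (take (length p) (x ∷ xs)) then 1 else 0) + occ p xs

Av : List (List ℕ) → ℕ → List (List ℕ)
Av ps n = filter (λ π → and (map (λ p → occ p π ≡ᵇ 0) ps) Data.Bool.≟ true) (perms n)

p132 p231 p321 p123 p213 p312 : List ℕ
p132 = 1 ∷ 3 ∷ 2 ∷ []
p231 = 2 ∷ 3 ∷ 1 ∷ []
p321 = 3 ∷ 2 ∷ 1 ∷ []
p123 = 1 ∷ 2 ∷ 3 ∷ []
p213 = 2 ∷ 1 ∷ 3 ∷ []
p312 = 3 ∷ 1 ∷ 2 ∷ []

𝒜 : ℕ → List (List ℕ)
𝒜 = Av (p132 ∷ p231 ∷ [])

totalOcc : (ℕ → List (List ℕ)) → List ℕ → ℕ → ℕ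
totalOcc A p n = sum (map (occ p) (A n))

-- a / d as a rational (0 when d = 0)
frac : ℕ → ℕ → ℚ
frac a zero = 0ℚ
frac a (suc d) = (+ a) / suc d

-- pop_A(p) = L :  p_n^A / (n |A_n|) → L  as n → ∞  (ε-N limit in ℚ)
PopEq : (ℕ → List (List ℕ)) → List ℕ → ℚ → Set
PopEq A p L = ∀ (ε : ℚ) → 0ℚ < ε → ∃ λ N → ∀ n → N Data.Nat.≤ n →
  ∣ frac (totalOcc A p n) (n * length (A n)) - L ∣ < ε

module Submission where

-- The largest entry n of a permutation with no consecutive 132 or 231 is its first or last entry: anywhere
-- else it would be a peak, and its two neighbours would form a 132 or a 231. Conversely, putting n at either
-- end of such a permutation of size n − 1 creates neither pattern. So 𝒜 n is, as a bag, the list 𝒱 n of the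
-- 2^(n−1) permutations that decrease to 1 and then increase. Putting the new maximum in front creates a single
-- new window, which is a 321 (a 312) exactly when the old first pair is a descent (an ascent); putting it at the
-- back acts likewise on 123 and 213 through the last pair. Summing over 𝒱 turns this into linear recurrences:
-- the totals T n of 321 and of 123 satisfy T (n + 1) = 2 T n + 2^(n−1) − 1, the recurrence that Pascal's rule
-- gives for ∑ₖ C(n−1,k)(k−1), so T n = (n−1)2^(n−2) − 2^(n−1) + 1; the totals of 213 and 312 are 2^(n−2) − 1.
-- Divided by n 2^(n−1), these are within O(1/n) of 1/2 and of 0.

open import Defs
open import Data.Nat using (ℕ; _+_; _*_; _∸_; _^_; _≤_; _≥_)
open import Data.Nat.Combinatorics using (_C_)
open import Data.List using (length; map; upTo)
open import Data.Nat.ListAction using (sum)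
open import Data.Rational using (½; 0ℚ)
open import Data.Product using (_×_)
open import Relation.Binary.PropositionalEquality using (_≡_)

open import Data.Bool as Bool using (Bool; true; false; _∧_; if_then_else_; T)
open import Data.Bool.ListAction using (and)
open import Data.Bool.Properties using (T-≡; ∧-conicalˡ; ∧-conicalʳ; ∧-zeroʳ)
open import Data.Empty using (⊥-elim)
open import Data.Integer as ℤ using (+[1+_]; -[1+_]; _⊖_)
import Data.Integer.Properties as ℤ
open import Data.List using (List; []; _∷_; _++_; _∷ʳ_; filter; concatMap; cartesianProductWith)
open import Data.List.Properties
  using (map-++; map-∘; map-cong; map-applyUpTo; applyUpTo-∷ʳ; length-++; length-map; filter-all; filter-accept;
         filter-reject; ∷-injective; ∷-injectiveˡ; ∷-injectiveʳ; ∷ʳ-injectiveˡ)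
open import Data.List.Membership.Propositional using (_∈_)
open import Data.List.Membership.Propositional.Properties
  using (∈-++⁺ˡ; ∈-++⁺ʳ; ∈-map⁺; ∈-map⁻; ∈-upTo⁺; ∈-upTo⁻; ∈-filter⁺; ∈-filter⁻;
         ∈-cartesianProductWith⁺; ∈-cartesianProductWith⁻)
open import Data.List.Membership.Propositional.Properties.WithK using (unique∧set⇒bag)
open import Data.List.Relation.Binary.BagAndSetEquality using (∼bag⇒↭)
open import Data.List.Relation.Binary.Permutation.Propositional using (_↭_)
open import Data.List.Relation.Binary.Permutation.Propositional.Properties using (↭-length) renaming (map⁺ to ↭-map⁺)
open import Data.List.Relation.Unary.All as All using (All; []; _∷_)
import Data.List.Relation.Unary.All.Properties as AllP
open import Data.List.Relation.Unary.AllPairs as AllPairs using ([]; _∷_)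
open import Data.List.Relation.Unary.Any using (here; there)
open import Data.List.Relation.Unary.Unique.Propositional using (Unique)
import Data.List.Relation.Unary.Unique.Propositional.Properties as UP
open import Data.Nat using (zero; suc; _<_; z≤n; s≤s; _<ᵇ_; _≡ᵇ_)
open import Data.Nat.Combinatorics using (nCk+nC[k+1]≡[n+1]C[k+1])
open import Data.Nat.Combinatorics.Specification using (k>n⇒nCk≡0)
open import Data.Nat.ListAction.Properties using (sum-++; sum-↭)
open import Data.Nat.Properties
open import Data.Nat.Tactic.RingSolver using (solve-∀)
open import Data.List.Membership.DecPropositional _≟_ using (_∈?_)
open import Data.Product using (_,_; proj₁; proj₂; ∃)
open import Data.Rational as ℚ using (mkℚ; toℚᵘ; ∣_∣; _-_) renaming (_<_ to _<ℚ_)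
import Data.Rational.Properties as ℚ
open import Data.Rational.Unnormalised as ℚᵘ using (ℚᵘ; mkℚᵘ)
import Data.Rational.Unnormalised.Properties as ℚᵘ
open import Data.Sum using (_⊎_; inj₁; inj₂)
open import Function using (_∘_; id)
open import Function.Bundles using (Equivalence; _⇔_; mk⇔)
open import Relation.Binary using (tri<; tri≈; tri>)
open import Relation.Binary.PropositionalEquality
open import Relation.Nullary using (¬_; ¬?; yes; no; contradiction)
open import Algebra.Properties.CommutativeSemigroup +-commutativeSemigroup using ()
  renaming (interchange to +-interchange)

-- Windows of length three

<⇒<ᵇ≡true : ∀ {x m} → x < m → (x <ᵇ m) ≡ true
<⇒<ᵇ≡true x<m = Equivalence.to T-≡ (<⇒<ᵇ x<m)

≤⇒<ᵇ≡false : ∀ {x m} → x ≤ m → (m <ᵇ x) ≡ false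
≤⇒<ᵇ≡false {zero} z≤n = refl
≤⇒<ᵇ≡false {suc x} {suc m} (s≤s x≤m) = ≤⇒<ᵇ≡false x≤m

==ᴮ-sound : ∀ {α β} → (α ==ᴮ β) ≡ true → α ≡ β
==ᴮ-sound {false} {false} _ = refl
==ᴮ-sound {true} {true} _ = refl

𝟙 : Bool → ℕ
𝟙 b = if b then 1 else 0

occ₃ : List ℕ → ℕ → ℕ → ℕ → ℕ
occ₃ p x y z = 𝟙 (orderIso p (x ∷ y ∷ z ∷ []))

descent ascent : ℕ → ℕ → ℕ
descent x y = 𝟙 (orderIso (2 ∷ 1 ∷ []) (x ∷ y ∷ []))
ascent x y = 𝟙 (orderIso (1 ∷ 2 ∷ []) (x ∷ y ∷ []))

module _ (a b c u v w : ℕ) where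
  private
    agree : ℕ → ℕ → ℕ → ℕ → Bool
    agree p q s t = (p <ᵇ q) ==ᴮ (s <ᵇ t)
    headPairs = (agree a b u v ∧ agree b a v u) ∧ ((agree a c u w ∧ agree c a w u) ∧ true)
    tailPairs = ((agree b c v w ∧ agree c b w v) ∧ true) ∧ true

    no-occ₃ : ¬ orderIso (a ∷ b ∷ c ∷ []) (u ∷ v ∷ w ∷ []) ≡ true → occ₃ (a ∷ b ∷ c ∷ []) u v w ≡ 0
    no-occ₃ ¬iso with orderIso (a ∷ b ∷ c ∷ []) (u ∷ v ∷ w ∷ [])
    ... | false = refl
    ... | true = ⊥-elim (¬iso refl)

  occ₃≡0-by₁₂ : ¬ (a <ᵇ b) ≡ (u <ᵇ v) → occ₃ (a ∷ b ∷ c ∷ []) u v w ≡ 0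
  occ₃≡0-by₁₂ ab≢uv = no-occ₃ λ e →
    ab≢uv (==ᴮ-sound (∧-conicalˡ _ _ (∧-conicalˡ _ _ (∧-conicalˡ headPairs tailPairs e))))

  occ₃≡0-by₁₃ : ¬ (a <ᵇ c) ≡ (u <ᵇ w) → occ₃ (a ∷ b ∷ c ∷ []) u v w ≡ 0
  occ₃≡0-by₁₃ ac≢uw = no-occ₃ λ e →
    ac≢uw (==ᴮ-sound (∧-conicalˡ _ _ (∧-conicalˡ _ _
      (∧-conicalʳ (agree a b u v ∧ agree b a v u) _ (∧-conicalˡ headPairs tailPairs e)))))

  occ₃≡0-by₂₃ : ¬ (b <ᵇ c) ≡ (v <ᵇ w) → occ₃ (a ∷ b ∷ c ∷ []) u v w ≡ 0
  occ₃≡0-by₂₃ bc≢vw = no-occ₃ λ e →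
    bc≢vw (==ᴮ-sound (∧-conicalˡ _ _ (∧-conicalˡ _ _ (∧-conicalˡ _ _ (∧-conicalʳ headPairs tailPairs e)))))

≡false⇒true≢ : ∀ {β} → β ≡ false → ¬ true ≡ β
≡false⇒true≢ refl ()

≡true⇒false≢ : ∀ {β} → β ≡ true → ¬ false ≡ β
≡true⇒false≢ refl ()

module _ {m x y : ℕ} (x<m : x < m) (y<m : y < m) where
  private
    m≮x = ≤⇒<ᵇ≡false (<⇒≤ x<m)
    m≮y = ≤⇒<ᵇ≡false (<⇒≤ y<m)
    x<ᵇm = <⇒<ᵇ≡true x<m
    y<ᵇm = <⇒<ᵇ≡true y<m

  occ₃-321-maxFirst : occ₃ p321 m x y ≡ descent x y
  occ₃-321-maxFirst rewrite m≮x | m≮y | x<ᵇm | y<ᵇm = refl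

  occ₃-312-maxFirst : occ₃ p312 m x y ≡ ascent x y
  occ₃-312-maxFirst rewrite m≮x | m≮y | x<ᵇm | y<ᵇm = refl

  occ₃-123-maxLast : occ₃ p123 x y m ≡ ascent x y
  occ₃-123-maxLast rewrite m≮x | m≮y | x<ᵇm | y<ᵇm = refl

  occ₃-213-maxLast : occ₃ p213 x y m ≡ descent x y
  occ₃-213-maxLast rewrite m≮x | m≮y | x<ᵇm | y<ᵇm = refl

  occ₃-123-maxFirst : occ₃ p123 m x y ≡ 0
  occ₃-123-maxFirst = occ₃≡0-by₁₂ 1 2 3 m x y (≡false⇒true≢ m≮x)

  occ₃-213-maxFirst : occ₃ p213 m x y ≡ 0
  occ₃-213-maxFirst = occ₃≡0-by₁₃ 2 1 3 m x y (≡false⇒true≢ m≮y)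

  occ₃-132-maxFirst : occ₃ p132 m x y ≡ 0
  occ₃-132-maxFirst = occ₃≡0-by₁₂ 1 3 2 m x y (≡false⇒true≢ m≮x)

  occ₃-231-maxFirst : occ₃ p231 m x y ≡ 0
  occ₃-231-maxFirst = occ₃≡0-by₁₂ 2 3 1 m x y (≡false⇒true≢ m≮x)

  occ₃-321-maxLast : occ₃ p321 x y m ≡ 0
  occ₃-321-maxLast = occ₃≡0-by₁₃ 3 2 1 x y m (≡true⇒false≢ x<ᵇm)

  occ₃-312-maxLast : occ₃ p312 x y m ≡ 0
  occ₃-312-maxLast = occ₃≡0-by₁₃ 3 1 2 x y m (≡true⇒false≢ x<ᵇm)

  occ₃-132-maxLast : occ₃ p132 x y m ≡ 0
  occ₃-132-maxLast = occ₃≡0-by₂₃ 1 3 2 x y m (≡true⇒false≢ y<ᵇm)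

  occ₃-231-maxLast : occ₃ p231 x y m ≡ 0
  occ₃-231-maxLast = occ₃≡0-by₂₃ 2 3 1 x y m (≡true⇒false≢ y<ᵇm)

module _ {m x : ℕ} (x<m : x < m) where
  descent-maxFirst : descent m x ≡ 1
  descent-maxFirst rewrite ≤⇒<ᵇ≡false (<⇒≤ x<m) | <⇒<ᵇ≡true x<m = refl

  ascent-maxFirst : ascent m x ≡ 0
  ascent-maxFirst rewrite ≤⇒<ᵇ≡false (<⇒≤ x<m) = refl

  descent-maxLast : descent x m ≡ 0
  descent-maxLast rewrite <⇒<ᵇ≡true x<m = refl

  ascent-maxLast : ascent x m ≡ 1
  ascent-maxLast rewrite ≤⇒<ᵇ≡false (<⇒≤ x<m) | <⇒<ᵇ≡true x<m = refl

-- Occurrences in a list extended at either end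

firstPair : (ℕ → ℕ → ℕ) → List ℕ → ℕ
firstPair f (x ∷ y ∷ _) = f x y
firstPair f _ = 0

lastPair : (ℕ → ℕ → ℕ) → List ℕ → ℕ
lastPair f (x ∷ y ∷ []) = f x y
lastPair f (x ∷ y ∷ z ∷ σ) = lastPair f (y ∷ z ∷ σ)
lastPair f _ = 0

module _ {m : ℕ} {f g : ℕ → ℕ → ℕ} (f≗g : ∀ {x y} → x < m → y < m → f x y ≡ g x y) where
  firstPair-cong : ∀ {σ} → All (_< m) σ → firstPair f σ ≡ firstPair g σ
  firstPair-cong [] = refl
  firstPair-cong (_ ∷ []) = refl
  firstPair-cong (x<m ∷ y<m ∷ _) = f≗g x<m y<m

  lastPair-cong : ∀ {σ} → All (_< m) σ → lastPair f σ ≡ lastPair g σ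
  lastPair-cong [] = refl
  lastPair-cong (_ ∷ []) = refl
  lastPair-cong (x<m ∷ y<m ∷ []) = f≗g x<m y<m
  lastPair-cong (_ ∷ bounds@(_ ∷ _ ∷ _)) = lastPair-cong bounds

module _ {m : ℕ} {f : ℕ → ℕ → ℕ} (f≡0 : ∀ {x y} → x < m → y < m → f x y ≡ 0) where
  firstPair≡0 : ∀ {σ} → All (_< m) σ → firstPair f σ ≡ 0
  firstPair≡0 [] = refl
  firstPair≡0 (_ ∷ []) = refl
  firstPair≡0 (x<m ∷ y<m ∷ _) = f≡0 x<m y<m

  lastPair≡0 : ∀ {σ} → All (_< m) σ → lastPair f σ ≡ 0
  lastPair≡0 [] = refl
  lastPair≡0 (_ ∷ []) = refl
  lastPair≡0 (x<m ∷ y<m ∷ []) = f≡0 x<m y<m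
  lastPair≡0 (_ ∷ bounds@(_ ∷ _ ∷ _)) = lastPair≡0 bounds

module _ {a b c : ℕ} where
  occ-pair : ∀ x y → occ (a ∷ b ∷ c ∷ []) (x ∷ y ∷ []) ≡ 0
  occ-pair x y = cong (λ β → 𝟙 β + 0) (∧-zeroʳ _)

  occ-∷ : ∀ m σ →
    occ (a ∷ b ∷ c ∷ []) (m ∷ σ) ≡ firstPair (occ₃ (a ∷ b ∷ c ∷ []) m) σ + occ (a ∷ b ∷ c ∷ []) σ
  occ-∷ m [] = refl
  occ-∷ m (x ∷ []) = occ-pair m x
  occ-∷ m (x ∷ y ∷ σ) = refl

  occ-∷ʳ : ∀ σ m →
    occ (a ∷ b ∷ c ∷ []) (σ ∷ʳ m) ≡ occ (a ∷ b ∷ c ∷ []) σ + lastPair (λ x y → occ₃ (a ∷ b ∷ c ∷ []) x y m) σ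
  occ-∷ʳ [] m = refl
  occ-∷ʳ (x ∷ []) m = occ-pair x m
  occ-∷ʳ (x ∷ y ∷ []) m = begin
    w + occ p (y ∷ m ∷ []) ≡⟨ cong (w +_) (occ-pair y m) ⟩
    w + 0                  ≡⟨ +-comm w 0 ⟩
    w                      ≡⟨ cong (_+ w) (occ-pair x y) ⟨
    occ p (x ∷ y ∷ []) + w ∎
    where
    open ≡-Reasoning
    p = a ∷ b ∷ c ∷ []
    w = occ₃ p x y m
  occ-∷ʳ (x ∷ y ∷ z ∷ σ) m = begin
    w + occ p ((y ∷ z ∷ σ) ∷ʳ m)   ≡⟨ cong (w +_) (occ-∷ʳ (y ∷ z ∷ σ) m) ⟩
    w + (occ p (y ∷ z ∷ σ) + last) ≡⟨ +-assoc w _ last ⟨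
    w + occ p (y ∷ z ∷ σ) + last   ∎
    where
    open ≡-Reasoning
    p = a ∷ b ∷ c ∷ []
    w = occ₃ p x y z
    last = lastPair (λ u v → occ₃ p u v m) (y ∷ z ∷ σ)

-- Av(132, 231) as an explicit list

InRange : ℕ → ℕ → Set
InRange n x = 1 ≤ x × x ≤ n

InRange-weaken : ∀ {n x} → InRange n x → InRange (suc n) x
InRange-weaken (1≤x , x≤n) = 1≤x , m≤n⇒m≤1+n x≤n

InRange-pred : ∀ {n x} → InRange (suc n) x → x ≢ suc n → InRange n x
InRange-pred (1≤x , x≤n+1) x≢n+1 = 1≤x , ≤-pred (≤∧≢⇒< x≤n+1 x≢n+1)

record Avoider (n : ℕ) (σ : List ℕ) : Set where
  field
    length≡ : length σ ≡ n
    inRange : All (InRange n) σ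
    unique : Unique σ
    avoids132 : occ p132 σ ≡ 0
    avoids231 : occ p231 σ ≡ 0

  below : All (_< suc n) σ
  below = All.map (s≤s ∘ proj₂) inRange

Unique-∷ʳ⁺ : ∀ {σ : List ℕ} {m} → Unique σ → All (_≢ m) σ → Unique (σ ∷ʳ m)
Unique-∷ʳ⁺ {σ} {m} σ! σ≢m = UP.++⁺ σ! ([] ∷ []) λ { (m∈σ , here refl) → All.lookup σ≢m m∈σ refl }

Unique-∷ʳ⁻ : ∀ (σ : List ℕ) {m} → Unique (σ ∷ʳ m) → Unique σ × All (_≢ m) σ
Unique-∷ʳ⁻ [] _ = [] , []
Unique-∷ʳ⁻ (x ∷ σ) (x∉ ∷ σm!) =
  let σ! , σ≢m = Unique-∷ʳ⁻ σ σm! in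
  AllP.++⁻ˡ σ x∉ ∷ σ! , All.head (AllP.++⁻ʳ σ x∉) ∷ σ≢m

module _ {n : ℕ} where
  private
    m = suc (suc n)

  Avoider-∷⁺ : ∀ {σ} → Avoider (suc n) σ → Avoider m (m ∷ σ)
  Avoider-∷⁺ {σ} av = record
    { length≡ = cong suc length≡
    ; inRange = (s≤s z≤n , ≤-refl) ∷ All.map InRange-weaken inRange
    ; unique = All.map (λ x<m m≡x → <⇒≢ x<m (sym m≡x)) below ∷ unique
    ; avoids132 = trans (occ-∷ m σ) (cong₂ _+_ (firstPair≡0 occ₃-132-maxFirst below) avoids132)
    ; avoids231 = trans (occ-∷ m σ) (cong₂ _+_ (firstPair≡0 occ₃-231-maxFirst below) avoids231)
    }
    where open Avoider av

  Avoider-∷ʳ⁺ : ∀ {σ} → Avoider (suc n) σ → Avoider m (σ ∷ʳ m)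
  Avoider-∷ʳ⁺ {σ} av = record
    { length≡ = trans (length-++ σ) (trans (cong (_+ 1) length≡) (+-comm (suc n) 1))
    ; inRange = AllP.++⁺ (All.map InRange-weaken inRange) ((s≤s z≤n , ≤-refl) ∷ [])
    ; unique = Unique-∷ʳ⁺ unique (All.map <⇒≢ below)
    ; avoids132 = trans (occ-∷ʳ σ m) (cong₂ _+_ avoids132 (lastPair≡0 occ₃-132-maxLast below))
    ; avoids231 = trans (occ-∷ʳ σ m) (cong₂ _+_ avoids231 (lastPair≡0 occ₃-231-maxLast below))
    }
    where open Avoider av

  Avoider-∷⁻ : ∀ {σ} → Avoider m (m ∷ σ) → Avoider (suc n) σ
  Avoider-∷⁻ {σ} av = record
    { length≡ = suc-injective length≡
    ; inRange = All.zipWith (λ (r , m≢x) → InRange-pred r (m≢x ∘ sym)) (All.tail inRange , AllPairs.head unique)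
    ; unique = AllPairs.tail unique
    ; avoids132 = m+n≡0⇒n≡0 _ avoids132
    ; avoids231 = m+n≡0⇒n≡0 _ avoids231
    }
    where open Avoider av

  Avoider-∷ʳ⁻ : ∀ {σ} → Avoider m (σ ∷ʳ m) → Avoider (suc n) σ
  Avoider-∷ʳ⁻ {σ} av = record
    { length≡ = suc-injective (trans (+-comm 1 (length σ)) (trans (sym (length-++ σ)) length≡))
    ; inRange = All.zipWith (λ (r , x≢m) → InRange-pred r x≢m) (AllP.++⁻ˡ σ inRange , σ≢m)
    ; unique = σ!
    ; avoids132 = m+n≡0⇒m≡0 _ (trans (sym (occ-∷ʳ σ m)) avoids132)
    ; avoids231 = m+n≡0⇒m≡0 _ (trans (sym (occ-∷ʳ σ m)) avoids231)
    }
    where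
    open Avoider av
    σ! = proj₁ (Unique-∷ʳ⁻ σ unique)
    σ≢m = proj₂ (Unique-∷ʳ⁻ σ unique)

length-filter-≢ : ∀ c {xs : List ℕ} → Unique xs → length xs ≤ suc (length (filter (λ x → ¬? (x ≟ c)) xs))
length-filter-≢ c {[]} [] = z≤n
length-filter-≢ c {x ∷ xs} (x∉xs ∷ xs!) with x ≟ c
... | yes refl rewrite filter-reject (λ y → ¬? (y ≟ c)) {x} {xs} (λ c≢c → c≢c refl)
                   | filter-all (λ y → ¬? (y ≟ c)) (All.map ≢-sym x∉xs) = ≤-refl
... | no x≢c rewrite filter-accept (λ y → ¬? (y ≟ c)) {x} {xs} x≢c = s≤s (length-filter-≢ c xs!)

Unique⇒length≤ : ∀ n {xs} → Unique xs → All (InRange n) xs → length xs ≤ n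
Unique⇒length≤ zero {[]} _ _ = z≤n
Unique⇒length≤ zero {_ ∷ _} _ ((1≤x , x≤0) ∷ _) = contradiction (≤-trans 1≤x x≤0) λ ()
Unique⇒length≤ (suc n) {xs} xs! inRange =
  ≤-trans (length-filter-≢ (suc n) xs!) (s≤s (Unique⇒length≤ n (UP.filter⁺ P? xs!) inRange′))
  where
  P? = λ x → ¬? (x ≟ suc n)
  inRange′ = All.zipWith (λ (r , x≢n+1) → InRange-pred r x≢n+1) (AllP.filter⁺ P? inRange , AllP.all-filter P? xs)

max∈Avoider : ∀ {n σ} → Avoider (suc n) σ → suc n ∈ σ
max∈Avoider {n} {σ} av with suc n ∈? σ
... | yes n+1∈σ = n+1∈σ
... | no n+1∉σ = contradiction (subst (_≤ n) length≡ (Unique⇒length≤ n unique inRange′)) (<-irrefl refl)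
  where
  open Avoider av
  inRange′ = All.zipWith (λ (r , x≢n+1) → InRange-pred r (≢-sym x≢n+1)) (inRange , AllP.¬Any⇒All¬ σ n+1∉σ)

peak-occurs : ∀ {x m y} → x < m → y < m → x ≢ y → occ₃ p132 x m y ≡ 1 ⊎ occ₃ p231 x m y ≡ 1
peak-occurs {x} {m} {y} x<m y<m x≢y with <-cmp x y
... | tri< x<y _ _ rewrite <⇒<ᵇ≡true x<m | ≤⇒<ᵇ≡false (<⇒≤ x<m) | <⇒<ᵇ≡true y<m | ≤⇒<ᵇ≡false (<⇒≤ y<m)
                         | <⇒<ᵇ≡true x<y | ≤⇒<ᵇ≡false (<⇒≤ x<y) = inj₁ refl
... | tri≈ _ x≡y _ = contradiction x≡y x≢y
... | tri> _ _ y<x rewrite <⇒<ᵇ≡true x<m | ≤⇒<ᵇ≡false (<⇒≤ x<m) | <⇒<ᵇ≡true y<m | ≤⇒<ᵇ≡false (<⇒≤ y<m)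
                         | <⇒<ᵇ≡true y<x | ≤⇒<ᵇ≡false (<⇒≤ y<x) = inj₂ refl

max-at-an-end : ∀ {m σ} → m ∈ σ → Unique σ → All (_≤ m) σ → occ p132 σ ≡ 0 → occ p231 σ ≡ 0 →
  (∃ λ τ → σ ≡ m ∷ τ) ⊎ (∃ λ τ → σ ≡ τ ∷ʳ m)
max-at-an-end (here refl) _ _ _ _ = inj₁ (_ , refl)
max-at-an-end {m} {x ∷ σ} (there m∈σ) (x∉σ ∷ σ!) (x≤m ∷ σ≤m) no132 no231
  with max-at-an-end m∈σ σ! σ≤m (m+n≡0⇒n≡0 _ no132) (m+n≡0⇒n≡0 _ no231)
... | inj₂ (τ , refl) = inj₂ (x ∷ τ , refl)
... | inj₁ ([] , refl) = inj₂ (x ∷ [] , refl)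
... | inj₁ (y ∷ τ , refl) with peak-occurs x<m y<m (All.head (All.tail x∉σ))
  where
  x<m = ≤∧≢⇒< x≤m (All.head x∉σ)
  y<m = ≤∧≢⇒< (All.head (All.tail σ≤m)) (≢-sym (All.head (AllPairs.head σ!)))
...   | inj₁ occurs = contradiction (trans (sym occurs) (m+n≡0⇒m≡0 _ no132)) λ ()
...   | inj₂ occurs = contradiction (trans (sym occurs) (m+n≡0⇒m≡0 _ no231)) λ ()

max-of-Avoider-at-an-end : ∀ {n σ} → Avoider (suc n) σ → (∃ λ τ → σ ≡ suc n ∷ τ) ⊎ (∃ λ τ → σ ≡ τ ∷ʳ suc n)
max-of-Avoider-at-an-end av = max-at-an-end (max∈Avoider av) unique (All.map proj₂ inRange) avoids132 avoids231
  where open Avoider av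

-- 𝒱 1 is listed on its own because both ends of the empty list give the same permutation.
𝒱 : ℕ → List (List ℕ)
𝒱 zero = [] ∷ []
𝒱 (suc zero) = (1 ∷ []) ∷ []
𝒱 (suc (suc n)) = map (suc (suc n) ∷_) (𝒱 (suc n)) ++ map (_∷ʳ suc (suc n)) (𝒱 (suc n))

𝒱-avoiders : ∀ n → All (Avoider n) (𝒱 n)
𝒱-avoiders zero = record { length≡ = refl ; inRange = [] ; unique = [] ; avoids132 = refl ; avoids231 = refl } ∷ []
𝒱-avoiders (suc zero) =
  record { length≡ = refl ; inRange = (≤-refl , ≤-refl) ∷ [] ; unique = [] ∷ [] ; avoids132 = refl ; avoids231 = refl } ∷ []
𝒱-avoiders (suc (suc n)) =
  AllP.++⁺ (AllP.map⁺ (All.map Avoider-∷⁺ (𝒱-avoiders (suc n)))) (AllP.map⁺ (All.map Avoider-∷ʳ⁺ (𝒱-avoiders (suc n))))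

Avoider⇒∈𝒱-step : ∀ {n} → (∀ {τ} → Avoider (suc n) τ → τ ∈ 𝒱 (suc n)) →
  ∀ {σ} → Avoider (suc (suc n)) σ → σ ∈ 𝒱 (suc (suc n))
Avoider⇒∈𝒱-step {n} ih av with max-of-Avoider-at-an-end av
... | inj₁ (τ , refl) = ∈-++⁺ˡ (∈-map⁺ (suc (suc n) ∷_) (ih (Avoider-∷⁻ av)))
... | inj₂ (τ , refl) = ∈-++⁺ʳ _ (∈-map⁺ (_∷ʳ suc (suc n)) (ih (Avoider-∷ʳ⁻ av)))

Avoider⇒∈𝒱 : ∀ n {σ} → Avoider n σ → σ ∈ 𝒱 n
Avoider⇒∈𝒱 zero {[]} _ = here refl
Avoider⇒∈𝒱 zero {_ ∷ _} record { length≡ = () }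
Avoider⇒∈𝒱 (suc zero) {[]} record { length≡ = () }
Avoider⇒∈𝒱 (suc zero) {_ ∷ _ ∷ _} record { length≡ = () }
Avoider⇒∈𝒱 (suc zero) {x ∷ []} record { inRange = (1≤x , x≤1) ∷ [] } rewrite ≤-antisym x≤1 1≤x = here refl
Avoider⇒∈𝒱 (suc (suc n)) = Avoider⇒∈𝒱-step (Avoider⇒∈𝒱 (suc n))

Unique-𝒱 : ∀ n → Unique (𝒱 n)
Unique-𝒱 zero = [] ∷ []
Unique-𝒱 (suc zero) = [] ∷ []
Unique-𝒱 (suc (suc n)) =
  UP.++⁺ (UP.map⁺ ∷-injectiveʳ (Unique-𝒱 (suc n))) (UP.map⁺ (∷ʳ-injectiveˡ _ _) (Unique-𝒱 (suc n))) disjoint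
  where
  m = suc (suc n)
  disjoint : ∀ {π} → ¬ (π ∈ map (m ∷_) (𝒱 (suc n)) × π ∈ map (_∷ʳ m) (𝒱 (suc n)))
  disjoint (π∈front , π∈back) with ∈-map⁻ (m ∷_) π∈front | ∈-map⁻ (_∷ʳ m) π∈back
  ... | _ , _ , refl | τ , τ∈𝒱 , m∷σ≡τ∷ʳm = head≢m (All.lookup (𝒱-avoiders (suc n)) τ∈𝒱) m∷σ≡τ∷ʳm
    where
    head≢m : ∀ {σ τ} → Avoider (suc n) τ → m ∷ σ ≢ τ ∷ʳ m
    head≢m {τ = []} record { length≡ = () }
    head≢m {τ = t ∷ _} av m∷σ≡τ∷ʳm = <-irrefl (sym (∷-injectiveˡ m∷σ≡τ∷ʳm)) (All.head (Avoider.below av))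

length-𝒱 : ∀ n → length (𝒱 (suc n)) ≡ 2 ^ n
length-𝒱 zero = refl
length-𝒱 (suc n) = begin
  length (map (suc (suc n) ∷_) V ++ map (_∷ʳ suc (suc n)) V) ≡⟨ length-++ (map (suc (suc n) ∷_) V) ⟩
  length (map _ V) + length (map _ V)                        ≡⟨ cong₂ _+_ (length-map _ V) (length-map _ V) ⟩
  length V + length V                                        ≡⟨ cong (λ l → l + l) (length-𝒱 n) ⟩
  2 ^ n + 2 ^ n                                              ≡⟨ cong (2 ^ n +_) (+-identityʳ (2 ^ n)) ⟨
  2 ^ suc n                                                  ∎
  where
  open ≡-Reasoning
  V = 𝒱 (suc n)

concatMap-map≡cartesianProductWith : ∀ {A B C : Set} (f : A → B → C) xs ys →
  concatMap (λ x → map (f x) ys) xs ≡ cartesianProductWith f xs ys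
concatMap-map≡cartesianProductWith f [] ys = refl
concatMap-map≡cartesianProductWith f (x ∷ xs) ys = cong (map (f x) ys ++_) (concatMap-map≡cartesianProductWith f xs ys)

allLists-suc : ∀ m k → allLists m (suc k) ≡ cartesianProductWith _∷_ (map suc (upTo m)) (allLists m k)
allLists-suc m k = concatMap-map≡cartesianProductWith _∷_ (map suc (upTo m)) (allLists m k)

∈-allLists⁺ : ∀ m {σ} → All (InRange m) σ → σ ∈ allLists m (length σ)
∈-allLists⁺ m [] = here refl
∈-allLists⁺ m {suc x ∷ σ} ((s≤s z≤n , x<m) ∷ inRange) = subst (_ ∈_) (sym (allLists-suc m (length σ)))
  (∈-cartesianProductWith⁺ _∷_ (∈-map⁺ suc (∈-upTo⁺ x<m)) (∈-allLists⁺ m inRange))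

∈-allLists⁻ : ∀ m k {σ} → σ ∈ allLists m k → length σ ≡ k × All (InRange m) σ
∈-allLists⁻ m zero (here refl) = refl , []
∈-allLists⁻ m (suc k) σ∈ with ∈-cartesianProductWith⁻ _∷_ (map suc (upTo m)) (allLists m k) (subst (_ ∈_) (allLists-suc m k) σ∈)
... | _ , τ , x∈ , τ∈ , refl with ∈-map⁻ suc x∈ | ∈-allLists⁻ m k τ∈
...   | i , i∈ , refl | length≡ , inRange = cong suc length≡ , (s≤s z≤n , ∈-upTo⁻ i∈) ∷ inRange

Unique-allLists : ∀ m k → Unique (allLists m k)
Unique-allLists m zero = [] ∷ []
Unique-allLists m (suc k) = subst Unique (sym (allLists-suc m k))
  (UP.cartesianProductWith⁺ _∷_ ∷-injective (UP.map⁺ suc-injective (UP.upTo⁺ m)) (Unique-allLists m k))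

≢⇒≡ᵇ≡false : ∀ {x y} → x ≢ y → (x ≡ᵇ y) ≡ false
≢⇒≡ᵇ≡false {x} {y} x≢y with x ≡ᵇ y in x≡ᵇy
... | false = refl
... | true = contradiction (≡ᵇ⇒≡ x y (subst T (sym x≡ᵇy) _)) x≢y

notIn⁺ : ∀ {x xs} → All (x ≢_) xs → notIn x xs ≡ true
notIn⁺ [] = refl
notIn⁺ (x≢y ∷ x∉xs) rewrite ≢⇒≡ᵇ≡false x≢y = notIn⁺ x∉xs

notIn⁻ : ∀ {x xs} → notIn x xs ≡ true → All (x ≢_) xs
notIn⁻ {xs = []} _ = []
notIn⁻ {x} {y ∷ ys} x∉ with x ≡ᵇ y in x≡ᵇy
... | false = (λ x≡y → subst T x≡ᵇy (≡⇒≡ᵇ x y x≡y)) ∷ notIn⁻ x∉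
notIn⁻ {x} {y ∷ ys} () | true

distinct⇔Unique : ∀ {xs} → distinct xs ≡ true ⇔ Unique xs
distinct⇔Unique = mk⇔ to from
  where
  to : ∀ {xs} → distinct xs ≡ true → Unique xs
  to {[]} _ = []
  to {x ∷ xs} d = notIn⁻ (∧-conicalˡ _ _ d) ∷ to (∧-conicalʳ (notIn x xs) _ d)
  from : ∀ {xs} → Unique xs → distinct xs ≡ true
  from [] = refl
  from (x∉xs ∷ xs!) rewrite notIn⁺ x∉xs = from xs!

≡ᵇ0⇔≡0 : ∀ {k} → (k ≡ᵇ 0) ≡ true ⇔ k ≡ 0
≡ᵇ0⇔≡0 {zero} = mk⇔ (λ _ → refl) (λ _ → refl)
≡ᵇ0⇔≡0 {suc k} = mk⇔ (λ ()) (λ ())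

∈𝒜⇔Avoider : ∀ {n σ} → σ ∈ 𝒜 n ⇔ Avoider n σ
∈𝒜⇔Avoider {n} {σ} = mk⇔ to from
  where
  distinct? = λ (xs : List ℕ) → distinct xs Bool.≟ true
  avoids? = λ π → and (map (λ p → occ p π ≡ᵇ 0) (p132 ∷ p231 ∷ [])) Bool.≟ true

  to : σ ∈ 𝒜 n → Avoider n σ
  to σ∈𝒜 = record
    { length≡ = proj₁ (∈-allLists⁻ n n σ∈allLists)
    ; inRange = proj₂ (∈-allLists⁻ n n σ∈allLists)
    ; unique = Equivalence.to distinct⇔Unique isDistinct
    ; avoids132 = Equivalence.to ≡ᵇ0⇔≡0 (∧-conicalˡ _ _ avoidsBoth)
    ; avoids231 = Equivalence.to ≡ᵇ0⇔≡0 (∧-conicalˡ _ _ (∧-conicalʳ (occ p132 σ ≡ᵇ 0) _ avoidsBoth))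
    }
    where
    σ∈perms = proj₁ (∈-filter⁻ avoids? {xs = perms n} σ∈𝒜)
    avoidsBoth = proj₂ (∈-filter⁻ avoids? {xs = perms n} σ∈𝒜)
    σ∈allLists = proj₁ (∈-filter⁻ distinct? {xs = allLists n n} σ∈perms)
    isDistinct = proj₂ (∈-filter⁻ distinct? {xs = allLists n n} σ∈perms)

  from : Avoider n σ → σ ∈ 𝒜 n
  from av = ∈-filter⁺ avoids? (∈-filter⁺ distinct? σ∈allLists (Equivalence.from distinct⇔Unique unique)) avoidsBoth
    where
    open Avoider av
    σ∈allLists = subst (λ k → σ ∈ allLists n k) length≡ (∈-allLists⁺ n inRange)
    avoidsBoth : and (map (λ p → occ p σ ≡ᵇ 0) (p132 ∷ p231 ∷ [])) ≡ true
    avoidsBoth rewrite avoids132 | avoids231 = refl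

Unique-𝒜 : ∀ n → Unique (𝒜 n)
Unique-𝒜 n = UP.filter⁺ _ (UP.filter⁺ _ (Unique-allLists n n))

𝒜↭𝒱 : ∀ n → 𝒜 n ↭ 𝒱 n
𝒜↭𝒱 n = ∼bag⇒↭ (unique∧set⇒bag (Unique-𝒜 n) (Unique-𝒱 n)
  (mk⇔ (Avoider⇒∈𝒱 n ∘ Equivalence.to ∈𝒜⇔Avoider) (Equivalence.from ∈𝒜⇔Avoider ∘ All.lookup (𝒱-avoiders n))))

length-𝒜 : ∀ n → length (𝒜 (suc n)) ≡ 2 ^ n
length-𝒜 n = trans (↭-length (𝒜↭𝒱 (suc n))) (length-𝒱 n)

-- Sums over 𝒱

module _ {A : Set} where
  sum-map-+ : ∀ (f g : A → ℕ) xs → sum (map (λ x → f x + g x) xs) ≡ sum (map f xs) + sum (map g xs)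
  sum-map-+ f g [] = refl
  sum-map-+ f g (x ∷ xs) rewrite sum-map-+ f g xs = +-interchange (f x) (g x) _ _

  sum-map-const : ∀ c (xs : List A) → sum (map (λ _ → c) xs) ≡ length xs * c
  sum-map-const c [] = refl
  sum-map-const c (x ∷ xs) = cong (c +_) (sum-map-const c xs)

  sum-map-cong : ∀ {P : A → Set} {f g : A → ℕ} → (∀ {x} → P x → f x ≡ g x) → ∀ {xs} → All P xs →
    sum (map f xs) ≡ sum (map g xs)
  sum-map-cong f≗g [] = refl
  sum-map-cong f≗g (px ∷ pxs) = cong₂ _+_ (f≗g px) (sum-map-cong f≗g pxs)

Σ𝒱 : (List ℕ → ℕ) → ℕ → ℕ
Σ𝒱 f n = sum (map f (𝒱 n))

totalOcc-𝒜 : ∀ p n → totalOcc 𝒜 p n ≡ Σ𝒱 (occ p) n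
totalOcc-𝒜 p n = sum-↭ (↭-map⁺ (occ p) (𝒜↭𝒱 n))

Σ𝒱-split : ∀ n g → Σ𝒱 g (2 + n) ≡ Σ𝒱 (λ σ → g (2 + n ∷ σ)) (suc n) + Σ𝒱 (λ σ → g (σ ∷ʳ (2 + n))) (suc n)
Σ𝒱-split n g = begin
  sum (map g (map (m ∷_) V ++ map (_∷ʳ m) V))           ≡⟨ cong sum (map-++ g (map (m ∷_) V) _) ⟩
  sum (map g (map (m ∷_) V) ++ map g (map (_∷ʳ m) V))   ≡⟨ sum-++ (map g (map (m ∷_) V)) _ ⟩
  sum (map g (map (m ∷_) V)) + sum (map g (map (_∷ʳ m) V)) ≡⟨ cong₂ _+_ (cong sum (map-∘ V)) (cong sum (map-∘ V)) ⟨
  Σ𝒱 (λ σ → g (m ∷ σ)) (suc n) + Σ𝒱 (λ σ → g (σ ∷ʳ m)) (suc n) ∎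
  where
  open ≡-Reasoning
  m = 2 + n
  V = 𝒱 (suc n)

Σ𝒱-cong : ∀ n {f g} → (∀ {σ} → 2 ≤ length σ → All (_< 3 + n) σ → f σ ≡ g σ) → Σ𝒱 f (2 + n) ≡ Σ𝒱 g (2 + n)
Σ𝒱-cong n f≗g = sum-map-cong (λ av → f≗g (length≥2 av) (Avoider.below av)) (𝒱-avoiders (2 + n))
  where
  length≥2 : ∀ {σ} → Avoider (2 + n) σ → 2 ≤ length σ
  length≥2 av = subst (2 ≤_) (sym (Avoider.length≡ av)) (s≤s (s≤s z≤n))

Σ𝒱-zero : ∀ n → Σ𝒱 (λ _ → 0) n ≡ 0
Σ𝒱-zero n = trans (sum-map-const 0 (𝒱 n)) (*-zeroʳ (length (𝒱 n)))

module _ (k : ℕ) {f : ℕ → ℕ → ℕ} {c : ℕ} where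
  private
    m = 3 + k

  Σ𝒱-firstPair-suc : (∀ {x} → x < m → f m x ≡ c) → Σ𝒱 (firstPair f) (3 + k) ≡ 2 ^ suc k * c + Σ𝒱 (firstPair f) (2 + k)
  Σ𝒱-firstPair-suc fmx≡c = trans (Σ𝒱-split (suc k) (firstPair f)) (cong₂ _+_ front (Σ𝒱-cong k back))
    where
    front : Σ𝒱 (λ σ → firstPair f (m ∷ σ)) (2 + k) ≡ 2 ^ suc k * c
    front = begin
      Σ𝒱 (λ σ → firstPair f (m ∷ σ)) (2 + k) ≡⟨ Σ𝒱-cong k (λ { {x ∷ _} _ (x<m ∷ _) → fmx≡c x<m }) ⟩
      Σ𝒱 (λ _ → c) (2 + k)                   ≡⟨ sum-map-const c (𝒱 (2 + k)) ⟩
      length (𝒱 (2 + k)) * c                 ≡⟨ cong (_* c) (length-𝒱 (suc k)) ⟩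
      2 ^ suc k * c                          ∎
      where open ≡-Reasoning
    back : ∀ {σ} → 2 ≤ length σ → All (_< m) σ → firstPair f (σ ∷ʳ m) ≡ firstPair f σ
    back {_ ∷ []} (s≤s ()) _
    back {_ ∷ _ ∷ _} _ _ = refl

  Σ𝒱-lastPair-suc : (∀ {x} → x < m → f x m ≡ c) → Σ𝒱 (lastPair f) (3 + k) ≡ Σ𝒱 (lastPair f) (2 + k) + 2 ^ suc k * c
  Σ𝒱-lastPair-suc fxm≡c = trans (Σ𝒱-split (suc k) (lastPair f)) (cong₂ _+_ (Σ𝒱-cong k front) back)
    where
    front : ∀ {σ} → 2 ≤ length σ → All (_< m) σ → lastPair f (m ∷ σ) ≡ lastPair f σ
    front {_ ∷ []} (s≤s ()) _
    front {_ ∷ _ ∷ _} _ _ = refl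
    lastPair-∷ʳ : ∀ {σ} → 1 ≤ length σ → All (_< m) σ → lastPair f (σ ∷ʳ m) ≡ c
    lastPair-∷ʳ {[]} () _
    lastPair-∷ʳ {x ∷ []} _ (x<m ∷ []) = fxm≡c x<m
    lastPair-∷ʳ {_ ∷ y ∷ []} _ (_ ∷ bounds) = lastPair-∷ʳ (s≤s z≤n) bounds
    lastPair-∷ʳ {_ ∷ y ∷ z ∷ σ} _ (_ ∷ bounds) = lastPair-∷ʳ (s≤s z≤n) bounds
    back : Σ𝒱 (λ σ → lastPair f (σ ∷ʳ m)) (2 + k) ≡ 2 ^ suc k * c
    back = begin
      Σ𝒱 (λ σ → lastPair f (σ ∷ʳ m)) (2 + k) ≡⟨ Σ𝒱-cong k (lastPair-∷ʳ ∘ ≤-trans (s≤s z≤n)) ⟩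
      Σ𝒱 (λ _ → c) (2 + k)                   ≡⟨ sum-map-const c (𝒱 (2 + k)) ⟩
      length (𝒱 (2 + k)) * c                 ≡⟨ cong (_* c) (length-𝒱 (suc k)) ⟩
      2 ^ suc k * c                          ∎
      where open ≡-Reasoning

Σ𝒱-occ-suc : ∀ k {a b c} (F G : List ℕ → ℕ) →
  (∀ {σ} → All (_< 3 + k) σ → firstPair (occ₃ (a ∷ b ∷ c ∷ []) (3 + k)) σ ≡ F σ) →
  (∀ {σ} → All (_< 3 + k) σ → lastPair (λ x y → occ₃ (a ∷ b ∷ c ∷ []) x y (3 + k)) σ ≡ G σ) →
  Σ𝒱 (occ (a ∷ b ∷ c ∷ [])) (3 + k) ≡ Σ𝒱 F (2 + k) + Σ𝒱 G (2 + k) + 2 * Σ𝒱 (occ (a ∷ b ∷ c ∷ [])) (2 + k)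
Σ𝒱-occ-suc k {a} {b} {c} F G first≡F last≡G = begin
  Σ𝒱 (occ p) (3 + k)                                                ≡⟨ Σ𝒱-split (suc k) (occ p) ⟩
  Σ𝒱 (λ σ → occ p (m ∷ σ)) (2 + k) + Σ𝒱 (λ σ → occ p (σ ∷ʳ m)) (2 + k)
    ≡⟨ cong₂ _+_ (Σ𝒱-cong k front) (Σ𝒱-cong k back) ⟩
  Σ𝒱 (λ σ → F σ + occ p σ) (2 + k) + Σ𝒱 (λ σ → occ p σ + G σ) (2 + k)
    ≡⟨ cong₂ _+_ (sum-map-+ F (occ p) V) (sum-map-+ (occ p) G V) ⟩
  (Σ𝒱 F (2 + k) + S) + (S + Σ𝒱 G (2 + k))                            ≡⟨ rearrange (Σ𝒱 F (2 + k)) S (Σ𝒱 G (2 + k)) ⟩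
  Σ𝒱 F (2 + k) + Σ𝒱 G (2 + k) + 2 * S                                ∎
  where
  open ≡-Reasoning
  p = a ∷ b ∷ c ∷ []
  m = 3 + k
  V = 𝒱 (2 + k)
  S = Σ𝒱 (occ p) (2 + k)
  front : ∀ {σ} → 2 ≤ length σ → All (_< m) σ → occ p (m ∷ σ) ≡ F σ + occ p σ
  front {σ} _ bounds = trans (occ-∷ m σ) (cong (_+ occ p σ) (first≡F bounds))
  back : ∀ {σ} → 2 ≤ length σ → All (_< m) σ → occ p (σ ∷ʳ m) ≡ occ p σ + G σ
  back {σ} _ bounds = trans (occ-∷ʳ σ m) (cong (occ p σ +_) (last≡G bounds))
  rearrange : ∀ f t g → (f + t) + (t + g) ≡ f + g + 2 * t
  rearrange = solve-∀

-- Closed forms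

doubling : ∀ (T : ℕ → ℕ) → T 0 ≡ 0 → (∀ k → T (suc k) ≡ 1 + 2 * T k) → ∀ k → T k + 1 ≡ 2 ^ k
doubling T T0≡0 rec zero = cong (_+ 1) T0≡0
doubling T T0≡0 rec (suc k) = begin
  T (suc k) + 1     ≡⟨ cong (_+ 1) (rec k) ⟩
  1 + 2 * T k + 1   ≡⟨ rearrange (T k) ⟩
  2 * (T k + 1)     ≡⟨ cong (2 *_) (doubling T T0≡0 rec k) ⟩
  2 * 2 ^ k         ∎
  where
  open ≡-Reasoning
  rearrange : ∀ t → 1 + 2 * t + 1 ≡ 2 * (t + 1)
  rearrange = solve-∀

geometric : ∀ (F : ℕ → ℕ) → F 0 ≡ 1 → (∀ k → F (suc k) ≡ 2 ^ suc k + F k) → ∀ k → F k + 1 ≡ 2 ^ suc k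
geometric F F0≡1 rec zero = cong (_+ 1) F0≡1
geometric F F0≡1 rec (suc k) = begin
  F (suc k) + 1           ≡⟨ cong (_+ 1) (rec k) ⟩
  2 ^ suc k + F k + 1     ≡⟨ +-assoc (2 ^ suc k) (F k) 1 ⟩
  2 ^ suc k + (F k + 1)   ≡⟨ cong (2 ^ suc k +_) (geometric F F0≡1 rec k) ⟩
  2 ^ suc k + 2 ^ suc k   ≡⟨ cong (2 ^ suc k +_) (+-identityʳ (2 ^ suc k)) ⟨
  2 ^ suc (suc k)         ∎
  where open ≡-Reasoning

linear-doubling : ∀ (T F : ℕ → ℕ) → T 0 ≡ 0 → (∀ k → F k + 1 ≡ 2 ^ suc k) → (∀ k → T (suc k) ≡ F k + 2 * T k) →
  ∀ k → T k + 2 ^ suc k ≡ suc k * 2 ^ k + 1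
linear-doubling T F T0≡0 F-closed rec zero = cong (_+ 2) T0≡0
linear-doubling T F T0≡0 F-closed rec (suc k) = +-cancelʳ-≡ 1 _ _ (begin
  T (suc k) + 2 ^ suc (suc k) + 1          ≡⟨ cong (λ t → t + 2 ^ suc (suc k) + 1) (rec k) ⟩
  F k + 2 * T k + 2 * (2 * h) + 1          ≡⟨ rearrange (F k) (T k) h ⟩
  (F k + 1) + 2 * (T k + 2 * h)            ≡⟨ cong₂ (λ a b → a + 2 * b) (F-closed k) (linear-doubling T F T0≡0 F-closed rec k) ⟩
  2 * h + 2 * (suc k * h + 1)              ≡⟨ collect k h ⟩
  suc (suc k) * (2 * h) + 1 + 1            ∎)
  where
  open ≡-Reasoning
  h = 2 ^ k
  rearrange : ∀ f t h → f + 2 * t + 2 * (2 * h) + 1 ≡ (f + 1) + 2 * (t + 2 * h)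
  rearrange = solve-∀
  collect : ∀ k h → 2 * h + 2 * (suc k * h + 1) ≡ suc (suc k) * (2 * h) + 1 + 1
  collect = solve-∀

Σ𝒱-descentFirst : ∀ k → Σ𝒱 (firstPair descent) (2 + k) + 1 ≡ 2 ^ suc k
Σ𝒱-descentFirst = geometric F refl λ k →
  trans (Σ𝒱-firstPair-suc k descent-maxFirst) (cong (_+ F k) (*-identityʳ (2 ^ suc k)))
  where F = λ k → Σ𝒱 (firstPair descent) (2 + k)

Σ𝒱-ascentLast : ∀ k → Σ𝒱 (lastPair ascent) (2 + k) + 1 ≡ 2 ^ suc k
Σ𝒱-ascentLast = geometric F refl λ k →
  trans (Σ𝒱-lastPair-suc k ascent-maxLast) (trans (+-comm (F k) _) (cong (_+ F k) (*-identityʳ (2 ^ suc k))))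
  where F = λ k → Σ𝒱 (lastPair ascent) (2 + k)

Σ𝒱-ascentFirst : ∀ k → Σ𝒱 (firstPair ascent) (2 + k) ≡ 1
Σ𝒱-ascentFirst zero = refl
Σ𝒱-ascentFirst (suc k) = begin
  Σ𝒱 (firstPair ascent) (3 + k)                 ≡⟨ Σ𝒱-firstPair-suc k ascent-maxFirst ⟩
  2 ^ suc k * 0 + Σ𝒱 (firstPair ascent) (2 + k) ≡⟨ cong₂ _+_ (*-zeroʳ (2 ^ suc k)) (Σ𝒱-ascentFirst k) ⟩
  1                                             ∎
  where open ≡-Reasoning

Σ𝒱-descentLast : ∀ k → Σ𝒱 (lastPair descent) (2 + k) ≡ 1
Σ𝒱-descentLast zero = refl
Σ𝒱-descentLast (suc k) = begin
  Σ𝒱 (lastPair descent) (3 + k)                 ≡⟨ Σ𝒱-lastPair-suc k descent-maxLast ⟩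
  Σ𝒱 (lastPair descent) (2 + k) + 2 ^ suc k * 0 ≡⟨ cong₂ _+_ (Σ𝒱-descentLast k) (*-zeroʳ (2 ^ suc k)) ⟩
  1                                             ∎
  where open ≡-Reasoning

Σ𝒱-321 : ∀ k → Σ𝒱 (occ p321) (2 + k) + 2 ^ suc k ≡ suc k * 2 ^ k + 1
Σ𝒱-321 = linear-doubling S F refl Σ𝒱-descentFirst λ k →
  trans (Σ𝒱-occ-suc k (firstPair descent) (λ _ → 0) (firstPair-cong occ₃-321-maxFirst) (lastPair≡0 occ₃-321-maxLast))
        (trans (cong (λ z → F k + z + 2 * S k) (Σ𝒱-zero (2 + k))) (cong (_+ 2 * S k) (+-identityʳ (F k))))
  where
  S = λ k → Σ𝒱 (occ p321) (2 + k)
  F = λ k → Σ𝒱 (firstPair descent) (2 + k)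

Σ𝒱-123 : ∀ k → Σ𝒱 (occ p123) (2 + k) + 2 ^ suc k ≡ suc k * 2 ^ k + 1
Σ𝒱-123 = linear-doubling S F refl Σ𝒱-ascentLast λ k →
  trans (Σ𝒱-occ-suc k (λ _ → 0) (lastPair ascent) (firstPair≡0 occ₃-123-maxFirst) (lastPair-cong occ₃-123-maxLast))
        (cong (λ z → z + F k + 2 * S k) (Σ𝒱-zero (2 + k)))
  where
  S = λ k → Σ𝒱 (occ p123) (2 + k)
  F = λ k → Σ𝒱 (lastPair ascent) (2 + k)

Σ𝒱-213 : ∀ k → Σ𝒱 (occ p213) (2 + k) + 1 ≡ 2 ^ k
Σ𝒱-213 = doubling S refl λ k →
  trans (Σ𝒱-occ-suc k (λ _ → 0) (lastPair descent) (firstPair≡0 occ₃-213-maxFirst) (lastPair-cong occ₃-213-maxLast))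
        (cong₂ (λ z w → z + w + 2 * S k) (Σ𝒱-zero (2 + k)) (Σ𝒱-descentLast k))
  where S = λ k → Σ𝒱 (occ p213) (2 + k)

Σ𝒱-312 : ∀ k → Σ𝒱 (occ p312) (2 + k) + 1 ≡ 2 ^ k
Σ𝒱-312 = doubling S refl λ k →
  trans (Σ𝒱-occ-suc k (firstPair ascent) (λ _ → 0) (firstPair-cong occ₃-312-maxFirst) (lastPair≡0 occ₃-312-maxLast))
        (cong₂ (λ z w → z + w + 2 * S k) (Σ𝒱-ascentFirst k) (Σ𝒱-zero (2 + k)))
  where S = λ k → Σ𝒱 (occ p312) (2 + k)

-- Binomial sums

∑< : ℕ → (ℕ → ℕ) → ℕ
∑< m f = sum (map f (upTo m))

syntax ∑< m (λ j → e) = ∑[ j < m ] e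

∑-head : ∀ m (f : ℕ → ℕ) → ∑[ j < suc m ] f j ≡ f 0 + ∑[ j < m ] f (suc j)
∑-head m f = cong (λ js → f 0 + sum js) (trans (map-applyUpTo suc f m) (sym (map-applyUpTo id (f ∘ suc) m)))

∑-last : ∀ m (f : ℕ → ℕ) → ∑[ j < suc m ] f j ≡ ∑[ j < m ] f j + f m
∑-last m f = begin
  sum (map f (upTo (suc m)))          ≡⟨ cong (sum ∘ map f) (applyUpTo-∷ʳ id m) ⟨
  sum (map f (upTo m ++ m ∷ []))      ≡⟨ cong sum (map-++ f (upTo m) (m ∷ [])) ⟩
  sum (map f (upTo m) ++ f m ∷ [])    ≡⟨ sum-++ (map f (upTo m)) (f m ∷ []) ⟩
  ∑[ j < m ] f j + (f m + 0)          ≡⟨ cong (∑[ j < m ] f j +_) (+-identityʳ (f m)) ⟩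
  ∑[ j < m ] f j + f m                ∎
  where open ≡-Reasoning

∑-cong : ∀ m {f g : ℕ → ℕ} → (∀ j → f j ≡ g j) → ∑[ j < m ] f j ≡ ∑[ j < m ] g j
∑-cong m f≗g = cong sum (map-cong f≗g (upTo m))

∑-+ : ∀ m (f g : ℕ → ℕ) → ∑[ j < m ] (f j + g j) ≡ ∑[ j < m ] f j + ∑[ j < m ] g j
∑-+ m f g = sum-map-+ f g (upTo m)

binomialSum weightedBinomialSum : ℕ → ℕ
binomialSum m = ∑[ j < m ] (m C suc j)
weightedBinomialSum m = ∑[ j < m ] ((m C suc j) * j)

binomialSum-suc : ∀ m → binomialSum (suc m) ≡ 1 + 2 * binomialSum m
binomialSum-suc m = begin
  ∑[ j < suc m ] (suc m C suc j)                       ≡⟨ ∑-cong (suc m) (λ j → sym (nCk+nC[k+1]≡[n+1]C[k+1] m j)) ⟩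
  ∑[ j < suc m ] (m C j + m C suc j)                   ≡⟨ ∑-+ (suc m) (m C_) (λ j → m C suc j) ⟩
  ∑[ j < suc m ] (m C j) + ∑[ j < suc m ] (m C suc j)  ≡⟨ cong₂ _+_ (∑-head m (m C_)) (∑-last m (λ j → m C suc j)) ⟩
  (1 + B) + (B + m C suc m)                            ≡⟨ cong (λ z → (1 + B) + (B + z)) (k>n⇒nCk≡0 (n<1+n m)) ⟩
  (1 + B) + (B + 0)                                    ≡⟨ +-assoc 1 B (B + 0) ⟩
  1 + 2 * B                                            ∎
  where
  open ≡-Reasoning
  B = binomialSum m

weightedBinomialSum-suc : ∀ m → weightedBinomialSum (suc m) ≡ binomialSum m + 2 * weightedBinomialSum m
weightedBinomialSum-suc m = begin
  ∑[ j < suc m ] ((suc m C suc j) * j)                             ≡⟨ ∑-cong (suc m) pascal ⟩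
  ∑[ j < suc m ] ((m C j) * j + (m C suc j) * j)                   ≡⟨ ∑-+ (suc m) (λ j → (m C j) * j) (λ j → (m C suc j) * j) ⟩
  ∑[ j < suc m ] ((m C j) * j) + ∑[ j < suc m ] ((m C suc j) * j)
    ≡⟨ cong₂ _+_ (∑-head m (λ j → (m C j) * j)) (∑-last m (λ j → (m C suc j) * j)) ⟩
  (0 + ∑[ j < m ] ((m C suc j) * suc j)) + (W + (m C suc m) * m)
    ≡⟨ cong₂ _+_ shift (cong (λ z → W + z * m) (k>n⇒nCk≡0 (n<1+n m))) ⟩
  (W + B) + (W + 0)                                                ≡⟨ rearrange W B ⟩
  B + 2 * W                                                        ∎
  where
  open ≡-Reasoning
  B = binomialSum m
  W = weightedBinomialSum m
  pascal : ∀ j → (suc m C suc j) * j ≡ (m C j) * j + (m C suc j) * j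
  pascal j = trans (cong (_* j) (sym (nCk+nC[k+1]≡[n+1]C[k+1] m j))) (*-distribʳ-+ j (m C j) (m C suc j))
  shift : ∑[ j < m ] ((m C suc j) * suc j) ≡ W + B
  shift = begin
    ∑[ j < m ] ((m C suc j) * suc j)          ≡⟨ ∑-cong m (λ j → trans (*-suc (m C suc j) j) (+-comm (m C suc j) _)) ⟩
    ∑[ j < m ] ((m C suc j) * j + m C suc j)  ≡⟨ ∑-+ m (λ j → (m C suc j) * j) (λ j → m C suc j) ⟩
    W + B                                     ∎
  rearrange : ∀ w b → (w + b) + (w + 0) ≡ b + 2 * w
  rearrange = solve-∀

binomialSum-closed : ∀ m → binomialSum m + 1 ≡ 2 ^ m
binomialSum-closed = doubling binomialSum refl binomialSum-suc

weightedBinomialSum-closed : ∀ k → weightedBinomialSum (suc k) + 2 ^ suc k ≡ suc k * 2 ^ k + 1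
weightedBinomialSum-closed = linear-doubling (weightedBinomialSum ∘ suc) (binomialSum ∘ suc) refl
  (binomialSum-closed ∘ suc) (weightedBinomialSum-suc ∘ suc)

-- Limits of the proportions

positive-numerator : ∀ {ε} → 0ℚ <ℚ ε → ∃ λ p → ℚ.↥ ε ≡ ℤ.+ suc p
positive-numerator {mkℚ +[1+ p ] _ _} _ = p , refl
positive-numerator {mkℚ (ℤ.+ zero) _ _} (ℚ.*<* (ℤ.+<+ ()))
positive-numerator {mkℚ -[1+ _ ] _ _} (ℚ.*<* ())

numerator-distance : ∀ a d l e → (ℤ.+ a ℤ.* ℤ.+ suc e) ℤ.+ (ℤ.- (ℤ.+ l)) ℤ.* (ℤ.+ suc d) ≡ (a * suc e) ⊖ (l * suc d)
numerator-distance a d l e = begin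
  (ℤ.+ a ℤ.* ℤ.+ suc e) ℤ.+ (ℤ.- (ℤ.+ l)) ℤ.* (ℤ.+ suc d)
    ≡⟨ cong₂ ℤ._+_ (ℤ.pos-* a (suc e)) (ℤ.neg-distribˡ-* (ℤ.+ l) (ℤ.+ suc d)) ⟨
  ℤ.+ (a * suc e) ℤ.+ ℤ.- (ℤ.+ l ℤ.* ℤ.+ suc d)
    ≡⟨ cong (λ z → ℤ.+ (a * suc e) ℤ.+ ℤ.- z) (ℤ.pos-* l (suc d)) ⟨
  ℤ.+ (a * suc e) ℤ.+ ℤ.- (ℤ.+ (l * suc d))
    ≡⟨ ℤ.m-n≡m⊖n (a * suc e) (l * suc d) ⟩
  (a * suc e) ⊖ (l * suc d)
    ∎
  where open ≡-Reasoning

frac-distance< : ∀ a d l e {L ε} → toℚᵘ L ≡ mkℚᵘ (ℤ.+ l) e → 0ℚ <ℚ ε →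
  ℤ.∣ (a * suc e) ⊖ (l * suc d) ∣ * ℚ.↧ₙ ε < suc d * suc e → ∣ frac a (suc d) - L ∣ <ℚ ε
frac-distance< a d l e {L} {ε@(mkℚ _ q _)} L≡l/e 0<ε X*q<de with positive-numerator 0<ε
... | p , refl = ℚ.toℚᵘ-cancel-< (ℚᵘ.<-respˡ-≃ (ℚᵘ.≃-sym toℚᵘ-distance) distance<ε)
  where
  distance : ℚᵘ
  distance = ℚᵘ.∣ mkℚᵘ (ℤ.+ a) d ℚᵘ.- mkℚᵘ (ℤ.+ l) e ∣
  toℚᵘ-distance : toℚᵘ (∣ frac a (suc d) - L ∣) ℚᵘ.≃ distance
  toℚᵘ-distance = ℚᵘ.≃-trans (ℚ.toℚᵘ-homo-∣-∣ (frac a (suc d) - L))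
    (ℚᵘ.∣-∣-cong (ℚᵘ.≃-trans (ℚ.toℚᵘ-homo-+ (frac a (suc d)) (ℚ.- L))
      (ℚᵘ.+-cong (ℚ.toℚᵘ-fromℚᵘ (mkℚᵘ (ℤ.+ a) d))
        (ℚᵘ.≃-trans (ℚ.toℚᵘ-homo‿- L) (ℚᵘ.≃-reflexive (cong ℚᵘ.-_ L≡l/e))))))
  X = ℤ.∣ (a * suc e) ⊖ (l * suc d) ∣
  X*q<p*de : X * suc q < suc p * (suc d * suc e)
  X*q<p*de = <-≤-trans X*q<de (m≤n*m (suc d * suc e) (suc p))
  distance<ε : distance ℚᵘ.< toℚᵘ ε
  distance<ε = ℚᵘ.*<* (subst₂ ℤ._<_
    (trans (ℤ.pos-* X (suc q)) (cong (λ z → ℤ.+ z ℤ.* ℤ.+ suc q) (sym (cong ℤ.∣_∣ (numerator-distance a d l e)))))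
    (ℤ.pos-* (suc p) (suc d * suc e)) (ℤ.+<+ X*q<p*de))

-- The bound says |totalOcc A p n / (n |A n|) − l/(e+1)| ≤ c/n for n ≥ 2, cross-multiplied.
PopEq-intro : ∀ A p {L} l e c → toℚᵘ L ≡ mkℚᵘ (ℤ.+ l) e →
  (∀ k → 0 < (2 + k) * length (A (2 + k)) ×
     ℤ.∣ (totalOcc A p (2 + k) * suc e) ⊖ (l * ((2 + k) * length (A (2 + k)))) ∣ * (2 + k)
       ≤ c * ((2 + k) * length (A (2 + k)) * suc e)) →
  PopEq A p L
PopEq-intro A p {L} l e c L≡l/e bound ε 0<ε = 2 + c * q , close
  where
  q = ℚ.↧ₙ ε
  close : ∀ n → 2 + c * q ≤ n → ∣ frac (totalOcc A p n) (n * length (A n)) - L ∣ <ℚ ε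
  close (suc (suc k)) (s≤s (s≤s cq≤k)) with (2 + k) * length (A (2 + k)) | bound k
  ... | suc d | _ , X*n≤cY = frac-distance< (totalOcc A p (2 + k)) d l e L≡l/e 0<ε (*-cancelʳ-< n (X * q) Y (begin-strict
    X * q * n   ≡⟨ swap X q n ⟩
    X * n * q   ≤⟨ *-monoˡ-≤ q X*n≤cY ⟩
    c * Y * q   ≡⟨ swap c Y q ⟩
    c * q * Y   <⟨ *-monoˡ-< Y (s≤s (≤-trans cq≤k (m≤n+m k 1))) ⟩
    n * Y       ≡⟨ *-comm n Y ⟩
    Y * n       ∎))
    where
    open ≤-Reasoning
    n = 2 + k
    X = ℤ.∣ (totalOcc A p n * suc e) ⊖ (l * suc d) ∣
    Y = suc d * suc e
    swap : ∀ x y z → x * y * z ≡ x * z * y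
    swap = solve-∀

∣⊖∣≤ : ∀ {m n c} → m ≤ n + c → n ≤ m + c → ℤ.∣ m ⊖ n ∣ ≤ c
∣⊖∣≤ {m} {n} m≤n+c n≤m+c with ≤-total m n
... | inj₁ m≤n rewrite ℤ.∣⊖∣-≤ m≤n = m≤n+o⇒m∸n≤o n m n≤m+c
... | inj₂ n≤m rewrite ℤ.∣m⊖n∣≡∣n⊖m∣ m n | ℤ.∣⊖∣-≤ n≤m = m≤n+o⇒m∸n≤o m n m≤n+c

distance-½ : ∀ k S → S + 2 ^ suc k ≡ suc k * 2 ^ k + 1 →
  ℤ.∣ (S * 2) ⊖ (1 * ((2 + k) * 2 ^ suc k)) ∣ * (2 + k) ≤ 2 * ((2 + k) * 2 ^ suc k * 2)
distance-½ k S closed = begin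
  ℤ.∣ (S * 2) ⊖ (1 * D) ∣ * (2 + k)   ≤⟨ *-monoˡ-≤ (2 + k) (∣⊖∣≤ upper lower) ⟩
  6 * h * (2 + k)                     ≤⟨ m≤m+n (6 * h * (2 + k)) (2 * h * (2 + k)) ⟩
  6 * h * (2 + k) + 2 * h * (2 + k)   ≡⟨ regroup k h ⟩
  2 * (D * 2)                         ∎
  where
  open ≤-Reasoning
  h = 2 ^ k
  D = (2 + k) * (2 * h)
  key : S * 2 + 6 * h ≡ 1 * D + 2
  key = trans (double S h) (trans (cong (λ z → 2 * z + 2 * h) closed) (collect k h))
    where
    double : ∀ s h → s * 2 + 6 * h ≡ 2 * (s + 2 * h) + 2 * h
    double = solve-∀
    collect : ∀ k h → 2 * (suc k * h + 1) + 2 * h ≡ 1 * ((2 + k) * (2 * h)) + 2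
    collect = solve-∀
  upper : S * 2 ≤ 1 * D + 6 * h
  upper = ≤-trans (m≤m+n (S * 2) (6 * h))
    (≤-trans (≤-reflexive key) (+-monoʳ-≤ (1 * D) (*-mono-≤ {2} {6} (s≤s (s≤s z≤n)) (m^n>0 2 k))))
  lower : 1 * D ≤ S * 2 + 6 * h
  lower = ≤-trans (m≤m+n (1 * D) 2) (≤-reflexive (sym key))
  regroup : ∀ k h → 6 * h * (2 + k) + 2 * h * (2 + k) ≡ 2 * ((2 + k) * (2 * h) * 2)
  regroup = solve-∀

distance-0 : ∀ k S → S + 1 ≡ 2 ^ k → ℤ.∣ (S * 1) ⊖ (0 * ((2 + k) * 2 ^ suc k)) ∣ * (2 + k) ≤ 1 * ((2 + k) * 2 ^ suc k * 1)
distance-0 k S closed = begin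
  S * 1 * (2 + k)               ≤⟨ *-monoˡ-≤ (2 + k) (≤-trans (≤-reflexive (*-identityʳ S)) (m≤m+n S 1)) ⟩
  (S + 1) * (2 + k)             ≡⟨ cong (_* (2 + k)) closed ⟩
  h * (2 + k)                   ≤⟨ m≤m+n (h * (2 + k)) (h * (2 + k)) ⟩
  h * (2 + k) + h * (2 + k)     ≡⟨ regroup k h ⟩
  1 * ((2 + k) * (2 * h) * 1)   ∎
  where
  open ≤-Reasoning
  h = 2 ^ k
  regroup : ∀ k h → h * (2 + k) + h * (2 + k) ≡ 1 * ((2 + k) * (2 * h) * 1)
  regroup = solve-∀

0<[2+k]*2^[1+k] : ∀ k → 0 < (2 + k) * 2 ^ suc k
0<[2+k]*2^[1+k] k = ≤-trans (m^n>0 2 (suc k)) (m≤m+n (2 ^ suc k) (suc k * 2 ^ suc k))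

PopEq-½ : ∀ p → (∀ k → Σ𝒱 (occ p) (2 + k) + 2 ^ suc k ≡ suc k * 2 ^ k + 1) → PopEq 𝒜 p ½
PopEq-½ p closed = PopEq-intro 𝒜 p 1 1 2 refl bound
  where
  bound : ∀ k → 0 < (2 + k) * length (𝒜 (2 + k)) ×
    ℤ.∣ (totalOcc 𝒜 p (2 + k) * 2) ⊖ (1 * ((2 + k) * length (𝒜 (2 + k)))) ∣ * (2 + k)
      ≤ 2 * ((2 + k) * length (𝒜 (2 + k)) * 2)
  bound k rewrite length-𝒜 (suc k) | totalOcc-𝒜 p (2 + k) = 0<[2+k]*2^[1+k] k , distance-½ k (Σ𝒱 (occ p) (2 + k)) (closed k)

PopEq-0 : ∀ p → (∀ k → Σ𝒱 (occ p) (2 + k) + 1 ≡ 2 ^ k) → PopEq 𝒜 p 0ℚ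
PopEq-0 p closed = PopEq-intro 𝒜 p 0 0 1 refl bound
  where
  bound : ∀ k → 0 < (2 + k) * length (𝒜 (2 + k)) ×
    ℤ.∣ (totalOcc 𝒜 p (2 + k) * 1) ⊖ (0 * ((2 + k) * length (𝒜 (2 + k)))) ∣ * (2 + k)
      ≤ 1 * ((2 + k) * length (𝒜 (2 + k)) * 1)
  bound k rewrite length-𝒜 (suc k) | totalOcc-𝒜 p (2 + k) = 0<[2+k]*2^[1+k] k , distance-0 k (Σ𝒱 (occ p) (2 + k)) (closed k)

totalOcc-321-closed : ∀ k → totalOcc 𝒜 p321 (2 + k) + 2 ^ suc k ≡ suc k * 2 ^ k + 1
totalOcc-321-closed k = trans (cong (_+ 2 ^ suc k) (totalOcc-𝒜 p321 (2 + k))) (Σ𝒱-321 k)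

totalOcc-321-binomial : ∀ k → totalOcc 𝒜 p321 (2 + k) ≡ sum (map (λ j → (suc k C j) * (j ∸ 1)) (map suc (upTo (suc k))))
totalOcc-321-binomial k = +-cancelʳ-≡ (2 ^ suc k) _ _ (begin
  totalOcc 𝒜 p321 (2 + k) + 2 ^ suc k      ≡⟨ totalOcc-321-closed k ⟩
  suc k * 2 ^ k + 1                        ≡⟨ weightedBinomialSum-closed k ⟨
  weightedBinomialSum (suc k) + 2 ^ suc k
    ≡⟨ cong (λ s → sum s + 2 ^ suc k) (map-∘ {g = λ j → (suc k C j) * (j ∸ 1)} {f = suc} (upTo (suc k))) ⟩
  sum (map (λ j → (suc k C j) * (j ∸ 1)) (map suc (upTo (suc k)))) + 2 ^ suc k ∎)
  where open ≡-Reasoning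

mainTheorem10 :
    (∀ n → 1 ≤ n → length (𝒜 n) ≡ 2 ^ (n ∸ 1))
    × (∀ n → n ≥ 2 →
        (totalOcc 𝒜 p321 n ≡ sum (map (λ k → ((n ∸ 1) C k) * (k ∸ 1)) (map Data.Nat.suc (upTo (n ∸ 1)))))
        × (totalOcc 𝒜 p321 n + 2 ^ (n ∸ 1) ≡ (n ∸ 1) * 2 ^ (n ∸ 2) + 1))
    × PopEq 𝒜 p321 ½ × PopEq 𝒜 p123 ½
    × PopEq 𝒜 p213 0ℚ × PopEq 𝒜 p312 0ℚ
mainTheorem10 =
  (λ { zero () ; (suc n) _ → length-𝒜 n }) ,
  (λ { zero () ; (suc zero) (s≤s ()) ; (suc (suc k)) _ → totalOcc-321-binomial k , totalOcc-321-closed k }) ,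
  PopEq-½ p321 Σ𝒱-321 , PopEq-½ p123 Σ𝒱-123 ,
  PopEq-0 p213 Σ𝒱-213 , PopEq-0 p312 Σ𝒱-312
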